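{- Let $\mathit{Prim}$ be the set of prime numbers larger than $4$. For each $n\in\mathit{Prim}$ fix any Boolean frame $\mathfrak{W}_n^\sharp$ obtained from $\mathfrak{W}_n$ by the construction below, and for $X\subseteq\mathit{Prim}$ let $\mathbf{V}^\sharp(X)=\mathbf{HSP}\{\mathfrak{W}_n^\sharp:n\in X\}$. Then for distinct $X,Y\subseteq\mathit{Prim}$ we have $\mathbf{V}^\sharp(X)\neq\mathbf{V}^\sharp(Y)$. In particular, there are continuum many normal, unit-preserving and semi-complemented varieties of Boolean frames lacking the congruence extension property.
   Context: A Boolean frame is an algebra $\langle A,\sqcap,-,0,f\rangle$ with $\langle A,\sqcap,-,0\rangle$ a Boolean algebra and $f:A\to A$ an arbitrary unary operation; it is normal if $f(0)=0$, unit-preserving if $f(1)=1$, semi-complemented if $f(-x)=-f(x)$ for all $x$. $\mathbf{HSP}(K)$ is the variety generated by $K$. An algebra has the congruence extension property (CEP) if for every subalgebra $B$ and congruence $\Theta$ of $B$ there is a congruence $\Psi$ of the algebra with $\Psi\cap(B\times B)=\Theta$; a variety lacks CEP if some member lacks it. Wheel frames: for $n\ge5$, $W_n=\{0,\dots,n-1\}\cup\{h\}$ and $R_n=\{\langle x,y\rangle: x,y<n,\ x-y\equiv -1,0,1\pmod n\}\cup\{\langle h,h\rangle\}\cup\{\langle h,x\rangle,\langle x,h\rangle:x<n\}$. $\mathfrak{W}_n$ is the complex algebra: the powerset Boolean algebra of $W_n$ with $f(S)=\{x\in W_n:\exists y\in S\ \langle x,y\rangle\in R_n\}$. Construction of $\mathfrak{A}^\sharp$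 for a normal, unit-preserving Boolean frame $\mathfrak{A}$ with at least 8 elements: its Boolean reduct is the direct product of two copies of the Boolean reduct of $\mathfrak{A}$, and its operation $f^\sharp$ satisfies $f^\sharp(\langle a,0\rangle)=\langle f(a),0\rangle$, $f^\sharp(\langle0,a\rangle)=\langle0,f(a)\rangle$, $f^\sharp(\langle a,1\rangle)=\langle -f(-a),1\rangle$, $f^\sharp(\langle1,a\rangle)=\langle1,-f(-a)\rangle$; and for $0<a<1$, $0<b<1$, $f^\sharp(\langle a,b\rangle)\in\{\langle0,0\rangle,\langle1,1\rangle\}$, chosen subject to: (i) $f^\sharp(\langle -a,-b\rangle)=-f^\sharp(\langle a,b\rangle)$; (ii) for every $0<x<1$ there are $0<y_1,y_2<1$ with $f^\sharp(\langle x,y_1\rangle)=\langle0,0\rangle$, $f^\sharp(\langle x,y_2\rangle)=\langle1,1\rangle$, and symmetrically for every $0<y<1$ there are $0<x_1,x_2<1$ with $f^\sharp(\langle x_1,y\rangle)=\langle0,0\rangle$, $f^\sharp(\langle x_2,y\rangle)=\langle1,1\rangle$. -}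

module Defs where

open import Level using (0ℓ) renaming (suc to lsuc)
open import Data.Nat.Base using (ℕ; zero; suc; _<_; _≡ᵇ_)
open import Data.Nat.Primality using (Prime)
open import Data.Bool.Base using (Bool; true; false; _∧_; _∨_; not)
open import Data.Fin.Base using (Fin; toℕ)
open import Data.Fin.Subset using (Subset; _∩_; ∁; ⊥; ⊤)
open import Data.Vec.Base using (lookup; tabulate; map; zipWith)
open import Data.Product.Base using (Σ; _×_; _,_; proj₁; proj₂)
open import Data.Sum.Base using (_⊎_)
open import Relation.Nullary using (¬_)
open import Relation.Unary using (Pred; _⊆_)
open import Relation.Binary.Core using (Rel)
open import Relation.Binary.Structures using (IsEquivalence)
open import Relation.Binary.PropositionalEquality using (_≡_; isEquivalence; cong; cong₂)

record Alg : Set₁ where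
  infixr 7 _⊓_
  infix  4 _≈_
  field
    Carrier : Set
    _≈_     : Rel Carrier 0ℓ
    isEquiv : IsEquivalence _≈_
    _⊓_     : Carrier → Carrier → Carrier
    -_      : Carrier → Carrier
    𝟘       : Carrier
    f       : Carrier → Carrier
    ⊓-cong  : ∀ {x x' y y'} → x ≈ x' → y ≈ y' → (x ⊓ y) ≈ (x' ⊓ y')
    neg-cong  : ∀ {x x'} → x ≈ x' → (- x) ≈ (- x')
    f-cong  : ∀ {x x'} → x ≈ x' → f x ≈ f x'

open Alg

record IsHom (A B : Alg) (h : Carrier A → Carrier B) : Set where
  field
    h-cong : ∀ {x y} → _≈_ A x y → _≈_ B (h x) (h y)
    h-⊓    : ∀ x y → _≈_ B (h (_⊓_ A x y)) (_⊓_ B (h x) (h y))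
    h-neg  : ∀ x → _≈_ B (h (-_ A x)) (-_ B (h x))
    h-𝟘    : _≈_ B (h (𝟘 A)) (𝟘 B)
    h-f    : ∀ x → _≈_ B (h (f A x)) (f B (h x))

Surjective : (A B : Alg) → (Carrier A → Carrier B) → Set
Surjective A B h = ∀ b → Σ (Carrier A) λ a → _≈_ B (h a) b

Π : (I : Set) → (I → Alg) → Alg
Π I A = record
  { Carrier = (i : I) → Carrier (A i)
  ; _≈_     = λ x y → ∀ i → _≈_ (A i) (x i) (y i)
  ; isEquiv = record
      { refl  = λ i → IsEquivalence.refl (isEquiv (A i))
      ; sym   = λ p i → IsEquivalence.sym (isEquiv (A i)) (p i)
      ; trans = λ p q i → IsEquivalence.trans (isEquiv (A i)) (p i) (q i) }
  ; _⊓_     = λ x y i → _⊓_ (A i) (x i) (y i)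
  ; -_      = λ x i → -_ (A i) (x i)
  ; 𝟘       = λ i → 𝟘 (A i)
  ; f       = λ x i → f (A i) (x i)
  ; ⊓-cong  = λ p q i → ⊓-cong (A i) (p i) (q i)
  ; neg-cong  = λ p i → neg-cong (A i) (p i)
  ; f-cong  = λ p i → f-cong (A i) (p i)
  }

record IsSubuniverse (A : Alg) (P : Pred (Carrier A) 0ℓ) : Set where
  field
    ⊓-closed : ∀ {x y} → P x → P y → P (_⊓_ A x y)
    neg-closed : ∀ {x} → P x → P (-_ A x)
    𝟘-closed : P (𝟘 A)
    f-closed : ∀ {x} → P x → P (f A x)

Sub : (A : Alg) (P : Pred (Carrier A) 0ℓ) → IsSubuniverse A P → Alg
Sub A P S = record
  { Carrier = Σ (Carrier A) P
  ; _≈_     = λ x y → _≈_ A (proj₁ x) (proj₁ y)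
  ; isEquiv = record
      { refl  = IsEquivalence.refl (isEquiv A)
      ; sym   = IsEquivalence.sym (isEquiv A)
      ; trans = IsEquivalence.trans (isEquiv A) }
  ; _⊓_     = λ x y → _⊓_ A (proj₁ x) (proj₁ y) , ⊓-closed (proj₂ x) (proj₂ y)
  ; -_      = λ x → -_ A (proj₁ x) , neg-closed (proj₂ x)
  ; 𝟘       = 𝟘 A , 𝟘-closed
  ; f       = λ x → f A (proj₁ x) , f-closed (proj₂ x)
  ; ⊓-cong  = ⊓-cong A
  ; neg-cong  = neg-cong A
  ; f-cong  = f-cong A
  }
  where open IsSubuniverse S

HSP : (J : Set) → (J → Alg) → Pred Alg (lsuc 0ℓ)
HSP J K A =
  Σ Set λ I → Σ (I → J) λ ι →
  Σ (Pred (Carrier (Π I (λ i → K (ι i)))) 0ℓ) λ P →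
  Σ (IsSubuniverse (Π I (λ i → K (ι i))) P) λ S →
  Σ (Carrier (Sub (Π I (λ i → K (ι i))) P S) → Carrier A) λ h →
  IsHom (Sub (Π I (λ i → K (ι i))) P S) A h × Surjective (Sub (Π I (λ i → K (ι i))) P S) A h

Class : Set₂
Class = Pred Alg (lsuc 0ℓ)

SameClass : Class → Class → Set₁
SameClass V W = ∀ A → (V A → W A) × (W A → V A)

record IsCongruence (A : Alg) (Θ : Rel (Carrier A) 0ℓ) : Set where
  field
    equiv  : IsEquivalence Θ
    ≈⊆Θ    : ∀ {x y} → _≈_ A x y → Θ x y
    ⊓-comp : ∀ {x x' y y'} → Θ x x' → Θ y y' → Θ (_⊓_ A x y) (_⊓_ A x' y')
    neg-comp : ∀ {x x'} → Θ x x' → Θ (-_ A x) (-_ A x')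
    f-comp : ∀ {x x'} → Θ x x' → Θ (f A x) (f A x')

CEP : Alg → Set₁
CEP A =
  (P : Pred (Carrier A) 0ℓ) (S : IsSubuniverse A P) →
  (Θ : Rel (Carrier (Sub A P S)) 0ℓ) → IsCongruence (Sub A P S) Θ →
  Σ (Rel (Carrier A) 0ℓ) λ Ψ → IsCongruence A Ψ ×
    (∀ (x y : Carrier (Sub A P S)) → (Ψ (proj₁ x) (proj₁ y) → Θ x y) × (Θ x y → Ψ (proj₁ x) (proj₁ y)))

LacksCEP : Class → Set₁
LacksCEP V = Σ Alg λ A → V A × ¬ CEP A

-- 1 is -0
NormalClass UnitPreservingClass SemiComplementedClass : Class → Set₁
NormalClass V = ∀ A → V A → _≈_ A (f A (𝟘 A)) (𝟘 A)
UnitPreservingClass V = ∀ A → V A → _≈_ A (f A (-_ A (𝟘 A))) (-_ A (𝟘 A))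
SemiComplementedClass V = ∀ A → V A → ∀ x → _≈_ A (f A (-_ A x)) (-_ A (f A x))

-- Wheel frames. W_n = Fin (suc n): the element with toℕ x = i < n is i,
-- the element with toℕ x = n (i.e. Fin.last) is the hub h.

sucMod : ℕ → ℕ → ℕ
sucMod n i = if-eq (suc i ≡ᵇ n)
  where
  if-eq : Bool → ℕ
  if-eq true  = 0
  if-eq false = suc i

R : (n : ℕ) → Fin (suc n) → Fin (suc n) → Bool
R n x y =
  (toℕ x ≡ᵇ n) ∨ (toℕ y ≡ᵇ n) ∨
  (toℕ x ≡ᵇ toℕ y) ∨ (sucMod n (toℕ x) ≡ᵇ toℕ y) ∨ (sucMod n (toℕ y) ≡ᵇ toℕ x)

anyFin : (m : ℕ) → (Fin m → Bool) → Bool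
anyFin zero    p = false
anyFin (suc m) p = p Fin.zero ∨ anyFin m (λ i → p (Fin.suc i))

fW : (n : ℕ) → Subset (suc n) → Subset (suc n)
fW n S = tabulate λ x → anyFin (suc n) λ y → lookup S y ∧ R n x y

𝔚 : ℕ → Alg
𝔚 n = record
  { Carrier = Subset (suc n) ; _≈_ = _≡_ ; isEquiv = isEquivalence
  ; _⊓_ = _∩_ ; -_ = ∁ ; 𝟘 = ⊥ ; f = fW n
  ; ⊓-cong = cong₂ _∩_ ; neg-cong = cong ∁ ; f-cong = cong (fW n) }

-- The ♯-construction applied to 𝔚_n: Boolean reduct = 𝒫(W_n) × 𝒫(W_n),
-- f♯ any operation satisfying the stated constraints.

Pair : ℕ → Set
Pair n = Subset (suc n) × Subset (suc n)

∁² : ∀ {n} → Pair n → Pair n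
∁² (a , b) = ∁ a , ∁ b

Proper : ∀ {n} → Subset (suc n) → Set
Proper a = ¬ (a ≡ ⊥) × ¬ (a ≡ ⊤)

record IsSharpOp (n : ℕ) (g : Pair n → Pair n) : Set where
  field
    on-a0 : ∀ a → g (a , ⊥) ≡ (fW n a , ⊥)
    on-0a : ∀ a → g (⊥ , a) ≡ (⊥ , fW n a)
    on-a1 : ∀ a → g (a , ⊤) ≡ (∁ (fW n (∁ a)) , ⊤)
    on-1a : ∀ a → g (⊤ , a) ≡ (⊤ , ∁ (fW n (∁ a)))
    proper-values : ∀ a b → Proper a → Proper b →
      (g (a , b) ≡ (⊥ , ⊥)) ⊎ (g (a , b) ≡ (⊤ , ⊤))
    cond-i : ∀ a b → Proper a → Proper b → g (∁ a , ∁ b) ≡ ∁² (g (a , b))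
    cond-ii-left : ∀ x → Proper x →
      (Σ (Subset (suc n)) λ y₁ → Proper y₁ × g (x , y₁) ≡ (⊥ , ⊥)) ×
      (Σ (Subset (suc n)) λ y₂ → Proper y₂ × g (x , y₂) ≡ (⊤ , ⊤))
    cond-ii-right : ∀ y → Proper y →
      (Σ (Subset (suc n)) λ x₁ → Proper x₁ × g (x₁ , y) ≡ (⊥ , ⊥)) ×
      (Σ (Subset (suc n)) λ x₂ → Proper x₂ × g (x₂ , y) ≡ (⊤ , ⊤))

SharpOp : ℕ → Set
SharpOp n = Σ (Pair n → Pair n) (IsSharpOp n)

𝔚♯ : (n : ℕ) → SharpOp n → Alg
𝔚♯ n g = record
  { Carrier = Pair n ; _≈_ = _≡_ ; isEquiv = isEquivalence
  ; _⊓_ = λ x y → (proj₁ x ∩ proj₁ y , proj₂ x ∩ proj₂ y)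
  ; -_ = ∁² ; 𝟘 = (⊥ , ⊥) ; f = proj₁ g
  ; ⊓-cong = λ p q → cong₂ (λ x y → (proj₁ x ∩ proj₁ y , proj₂ x ∩ proj₂ y)) p q
  ; neg-cong = cong ∁² ; f-cong = cong (proj₁ g) }

Prim : Pred ℕ 0ℓ
Prim n = Prime n × 4 < n

SharpChoice : Set
SharpChoice = (n : ℕ) → Prim n → SharpOp n

V♯ : SharpChoice → (X : Pred ℕ 0ℓ) → X ⊆ Prim → Class
V♯ F X X⊆Prim = HSP (Σ ℕ X) λ j → 𝔚♯ (proj₁ j) (F (proj₁ j) (X⊆Prim (proj₂ j)))

{-# OPTIONS --safe #-}
-- In 𝔚♯ₘ the term uₜ = f f (f f x₀ ⊓ - f x₀) always evaluates into one of the two axes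
-- 𝒫(Wₘ)×{∅} and {∅}×𝒫(Wₘ): on pairs of proper sets f♯ only takes the values 0 and 1, and on
-- pairs with a trivial coordinate it acts coordinatewise.  Each axis is a copy of 𝔚ₘ for ∅, ∪, ∩,
-- relative complement and f, so below uₜ the equation separatorₜ n ≈ 0 says that in 𝔚ₘ
--   a₀ ∖ f f D = ∅,   D = ⋃{aᵢ ∩ f aⱼ : i, j not adjacent in the n-cycle} ∪ ⋃ᵢ (aᵢ ∖ f aᵢ₊₁).
-- If D ≠ ∅ then f f D = Wₘ, through the hub.  If D = ∅, a point of a₀ starts a walk that avoids
-- the hub and goes around the rim of Wₘ in a fixed direction while its label goes around the
-- n-cycle, which forces n ∣ m.  So for primes n ≠ m the equation holds in 𝔚♯ₘ, and it fails in
-- 𝔚♯ₙ at aᵢ = {i}; as equations are preserved by H, S and P, any n ∈ X ∖ Y separates V♯(X)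
-- from V♯(Y).
-- CEP fails in 𝔚♯ₙ: on the subalgebra 𝒫(Wₙ)×{∅, Wₙ}, "same second coordinate" identifies (1, 1)
-- with (0, 1), so any extension identifies each (a, b) with (0, b); by condition (ii) some
-- f♯(a, b) is 0 and some is 1, so it would identify 0 with 1.
module Submission where

open import Defs
open import Level using (0ℓ)
open import Algebra.Lattice.Properties.BooleanAlgebra as BooleanAlgebraProperties using ()
open import Data.Bool.Base using (Bool; true; false; T; _∧_; _∨_)
open import Data.Bool.Properties using (T-≡; T-∧; T-∨; _≟_)
open import Data.Empty using (⊥-elim)
open import Data.Fin.Base using (Fin; toℕ; fromℕ; fromℕ<) renaming (zero to fzero; suc to fsuc)
open import Data.Fin.Properties using (toℕ-injective; toℕ-fromℕ; toℕ-fromℕ<; toℕ≤pred[n])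
open import Data.Fin.Subset using (Subset; _∈_; _∉_; _∩_; _∪_; ∁; ⊥; ⊤; Nonempty; Empty)
open import Data.Fin.Subset.Properties
  using (∉⊥; ∈⊤; ⊆⊤; ⊆-antisym; Empty-unique; _∈?_; nonempty?; x∈p∩q⁺; x∈p∩q⁻; x∈p∪q⁺; x∈p∪q⁻;
         x∉p⇒x∈∁p; x∈∁p⇒x∉p; ∩-zeroˡ; ∩-zeroʳ; ∩-inverseʳ; ∩-identityˡ; ∩-identityʳ; ∪-identityˡ;
         ∪-∩-booleanAlgebra)
open import Data.Nat.Base
  using (ℕ; zero; suc; _+_; _*_; _<_; _≤_; _≡ᵇ_; NonZero; >-nonZero; >-nonZero⁻¹; z≤n; s≤s; z<s)
open import Data.Nat.Properties
  using (≡ᵇ⇒≡; ≡⇒≡ᵇ; suc-injective; +-identityʳ; +-suc; +-cancelˡ-≡; <-irrefl; ≤-refl; ≤-trans;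
         ≤-<-trans; ≤∧≢⇒<; m<1+n⇒m<n∨m≡n; m<n⇒m<1+n)
open import Data.Nat.DivMod
  using (_%_; _/_; m%n<n; m<n⇒m%n≡m; m≡m%n+[m/n]*n; [m+n]%n≡m%n; [m+kn]%n≡m%n; n%n≡0;
         %-distribˡ-+; m%n%n≡m%n)
open import Data.Nat.Divisibility using (_∣_; divides; ∣⇒≤; m%n≡0⇒n∣m)
open import Data.Nat.Primality using (Prime; prime⇒irreducible)
open import Data.Product.Base using (Σ; ∃-syntax; _×_; _,_; proj₁; proj₂)
open import Data.Sum.Base as Sum using (_⊎_; inj₁; inj₂)
open import Data.Unit.Base using (tt) renaming (⊤ to Unit)
open import Data.Vec.Base using (tabulate; lookup)
open import Data.Vec.Properties using (≡-dec; lookup∘tabulate; lookup⇒[]=; []=⇒lookup)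
open import Function.Base using (_∘_)
open import Function.Bundles using (Equivalence)
open import Relation.Binary.Bundles using (Setoid)
open import Relation.Binary.Core using (Rel)
open import Relation.Binary.Definitions using (DecidableEquality)
open import Relation.Binary.PropositionalEquality
  using (_≡_; _≢_; refl; sym; trans; cong; cong₂; subst; subst₂; module ≡-Reasoning)
import Relation.Binary.Reasoning.Setoid as SetoidReasoning
open import Relation.Binary.Structures using (IsEquivalence)
open import Relation.Nullary using (¬_; Dec; yes; no)
open import Relation.Nullary.Decidable using (map′; T?)
open import Relation.Unary using (Pred; _⊆_)

open Equivalence using (to; from)

module _ {k : ℕ} where
  private module BA = BooleanAlgebraProperties (∪-∩-booleanAlgebra k)

  ∁-involutive : (p : Subset k) → ∁ (∁ p) ≡ p
  ∁-involutive = BA.¬-involutive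

  ∁⊥≡⊤ : ∁ ⊥ ≡ ⊤ {k}
  ∁⊥≡⊤ = BA.¬⊥≈⊤

  ∁⊤≡⊥ : ∁ ⊤ ≡ ⊥ {k}
  ∁⊤≡⊥ = BA.¬⊤≈⊥

  ∁-∩-∁ : (p q : Subset k) → ∁ (∁ p ∩ ∁ q) ≡ p ∪ q
  ∁-∩-∁ p q = trans (BA.deMorgan₁ (∁ p) (∁ q)) (cong₂ _∪_ (∁-involutive p) (∁-involutive q))

  ∁[∁⊥∩∁⊥]≡⊥ : ∁ (∁ ⊥ ∩ ∁ ⊥) ≡ ⊥ {k}
  ∁[∁⊥∩∁⊥]≡⊥ = trans (∁-∩-∁ ⊥ ⊥) (∪-identityˡ ⊥)

  ∈-tabulate⁺ : (b : Fin k → Bool) {x : Fin k} → T (b x) → x ∈ tabulate b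
  ∈-tabulate⁺ b {x} bx = lookup⇒[]= x _ (trans (lookup∘tabulate b x) (to T-≡ bx))

  ∈-tabulate⁻ : (b : Fin k → Bool) {x : Fin k} → x ∈ tabulate b → T (b x)
  ∈-tabulate⁻ b {x} x∈ = from T-≡ (trans (sym (lookup∘tabulate b x)) ([]=⇒lookup x∈))

  ∈⇒T-lookup : {p : Subset k} {x : Fin k} → x ∈ p → T (lookup p x)
  ∈⇒T-lookup x∈ = from T-≡ ([]=⇒lookup x∈)

  T-lookup⇒∈ : {p : Subset k} {x : Fin k} → T (lookup p x) → x ∈ p
  T-lookup⇒∈ {p} {x} t = lookup⇒[]= x p (to T-≡ t)

  point : ℕ → Subset k
  point i = tabulate λ x → toℕ x ≡ᵇ i

  ∈-point⁺ : {x : Fin k} {i : ℕ} → toℕ x ≡ i → x ∈ point i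
  ∈-point⁺ {x} {i} eq = ∈-tabulate⁺ (λ y → toℕ y ≡ᵇ i) (≡⇒≡ᵇ _ _ eq)

  ∈-point⁻ : {x : Fin k} {i : ℕ} → x ∈ point i → toℕ x ≡ i
  ∈-point⁻ {x} {i} x∈ = ≡ᵇ⇒≡ _ _ (∈-tabulate⁻ (λ y → toℕ y ≡ᵇ i) x∈)

_≟ˢ_ : ∀ {k} → DecidableEquality (Subset k)
_≟ˢ_ = ≡-dec _≟_

Trivial : ∀ {k} → Subset k → Set
Trivial a = a ≡ ⊥ ⊎ a ≡ ⊤

trivial-or-proper : ∀ {m} (a : Subset (suc m)) → Trivial a ⊎ Proper a
trivial-or-proper a with a ≟ˢ ⊥ | a ≟ˢ ⊤
... | yes a≡⊥ | _       = inj₁ (inj₁ a≡⊥)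
... | no _    | yes a≡⊤ = inj₁ (inj₂ a≡⊤)
... | no a≢⊥  | no a≢⊤  = inj₂ (a≢⊥ , a≢⊤)

point0-proper : ∀ {n} → 0 < n → Proper (point {suc n} 0)
point0-proper {suc n} _ = (λ eq → ∉⊥ (subst (fzero ∈_) eq (∈-point⁺ refl)))
                        , (λ eq → 1≢0 (∈-point⁻ (subst (fsuc fzero ∈_) (sym eq) ∈⊤)))
  where
  1≢0 : 1 ≢ 0
  1≢0 ()

T-∨ˡ : ∀ {x} y → T x → T (x ∨ y)
T-∨ˡ {x} y = from (T-∨ {x} {y}) ∘ inj₁

T-∨ʳ : ∀ x {y} → T y → T (x ∨ y)
T-∨ʳ x {y} = from (T-∨ {x} {y}) ∘ inj₂

anyFin⁺ : ∀ k (p : Fin k → Bool) (i : Fin k) → T (p i) → T (anyFin k p)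
anyFin⁺ (suc k) p fzero    pi = T-∨ˡ _ pi
anyFin⁺ (suc k) p (fsuc i) pi = T-∨ʳ (p fzero) (anyFin⁺ k (p ∘ fsuc) i pi)

anyFin⁻ : ∀ k (p : Fin k → Bool) → T (anyFin k p) → ∃[ i ] T (p i)
anyFin⁻ (suc k) p any with to T-∨ any
... | inj₁ p0 = fzero , p0
... | inj₂ ps with anyFin⁻ k (p ∘ fsuc) ps
...   | i , pi = fsuc i , pi

[1+m%n]%n≡[1+m]%n : ∀ m n .{{_ : NonZero n}} → suc (m % n) % n ≡ suc m % n
[1+m%n]%n≡[1+m]%n m n = begin
  suc (m % n) % n                 ≡⟨ sym ([m+kn]%n≡m%n (suc (m % n)) (m / n) n) ⟩
  (suc (m % n) + m / n * n) % n   ≡⟨ cong (λ j → suc j % n) (sym (m≡m%n+[m/n]*n m n)) ⟩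
  suc m % n                       ∎
  where open ≡-Reasoning

>4⇒NonZero : ∀ {n} → 4 < n → NonZero n
>4⇒NonZero 4<n = >-nonZero (≤-<-trans z≤n 4<n)

0%n≡0 : ∀ n .{{_ : NonZero n}} → 0 % n ≡ 0
0%n≡0 n = m<n⇒m%n≡m (>-nonZero⁻¹ n)

[m+0]%n≡m : ∀ {m n} .{{_ : NonZero n}} → m < n → (m + 0) % n ≡ m
[m+0]%n≡m {m} {n} m<n = trans (cong (_% n) (+-identityʳ m)) (m<n⇒m%n≡m m<n)

sucMod-% : ∀ n .{{_ : NonZero n}} k → sucMod n (k % n) ≡ suc k % n
sucMod-% n k with suc (k % n) ≡ᵇ n in eq
... | true  = begin
  0                ≡⟨ sym (n%n≡0 n) ⟩
  n % n            ≡⟨ cong (_% n) (sym (≡ᵇ⇒≡ _ _ (from T-≡ eq))) ⟩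
  suc (k % n) % n  ≡⟨ [1+m%n]%n≡[1+m]%n k n ⟩
  suc k % n        ∎
  where open ≡-Reasoning
... | false = begin
  suc (k % n)      ≡⟨ sym (m<n⇒m%n≡m (≤∧≢⇒< (m%n<n k n) (λ e → subst T eq (≡⇒≡ᵇ _ _ e)))) ⟩
  suc (k % n) % n  ≡⟨ [1+m%n]%n≡[1+m]%n k n ⟩
  suc k % n        ∎
  where open ≡-Reasoning

sucMod-< : ∀ {n} .{{_ : NonZero n}} {i} → i < n → sucMod n i ≡ suc i % n
sucMod-< {n} {i} i<n = trans (cong (sucMod n) (sym (m<n⇒m%n≡m i<n))) (sucMod-% n i)

sucMod<n : ∀ {n} .{{_ : NonZero n}} {i} → i < n → sucMod n i < n
sucMod<n {n} {i} i<n = subst (_< n) (sym (sucMod-< i<n)) (m%n<n (suc i) n)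

sucMod-injective : ∀ n {i j} → sucMod n i ≡ sucMod n j → i ≡ j
sucMod-injective n {i} {j} eq with suc i ≡ᵇ n in ei | suc j ≡ᵇ n in ej
... | true  | true  =
  suc-injective (trans (≡ᵇ⇒≡ (suc i) n (from T-≡ ei)) (sym (≡ᵇ⇒≡ (suc j) n (from T-≡ ej))))
... | false | false = suc-injective eq
... | true  | false with () ← eq
... | false | true  with () ← eq

sucMod-+% : ∀ n .{{_ : NonZero n}} i d → sucMod n ((i + d) % n) ≡ (i + suc d) % n
sucMod-+% n i d = trans (sucMod-% n (i + d)) (cong (_% n) (sym (+-suc i d)))

[m+d]%n≢m : ∀ {n} .{{_ : NonZero n}} m {d} → 0 < d → d < n → (m + d) % n ≢ m
[m+d]%n≢m {n} m {suc d} _ d<n eq = <-irrefl refl (≤-trans d<n (∣⇒≤ n∣d))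
  where
  n∣d : n ∣ suc d
  n∣d = divides ((m + suc d) / n)
          (+-cancelˡ-≡ m _ _ (trans (m≡m%n+[m/n]*n (m + suc d) n) (cong (_+ (m + suc d) / n * n) eq)))

[m%d+n]%d≡[m+n]%d : ∀ m n d .{{_ : NonZero d}} → (m % d + n) % d ≡ (m + n) % d
[m%d+n]%d≡[m+n]%d m n d = begin
  (m % d + n) % d          ≡⟨ %-distribˡ-+ (m % d) n d ⟩
  (m % d % d + n % d) % d  ≡⟨ cong (λ i → (i + n % d) % d) (m%n%n≡m%n m d) ⟩
  (m % d + n % d) % d      ≡⟨ sym (%-distribˡ-+ m n d) ⟩
  (m + n) % d              ∎
  where open ≡-Reasoning

prime-∤ : ∀ {m n} → Prime m → 1 < n → n ≢ m → ¬ n ∣ m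
prime-∤ m-prime 1<n n≢m n∣m with prime⇒irreducible m-prime n∣m
... | inj₁ n≡1 = <-irrefl (sym n≡1) 1<n
... | inj₂ n≡m = n≢m n≡m

data Dir : Set where
  fwd bwd : Dir

Step : ℕ → Dir → ℕ → ℕ → Set
Step n fwd i j = sucMod n i ≡ j
Step n bwd i j = sucMod n j ≡ i

Adjacent : ℕ → ℕ → ℕ → Set
Adjacent n i j = i ≡ j ⊎ ∃[ δ ] Step n δ i j

¬Adjacent-skip : ∀ {n} .{{_ : NonZero n}} {i} → 4 < n → i < n → ¬ Adjacent n i (sucMod n (sucMod n i))
¬Adjacent-skip {n} {i} 4<n i<n = λ where
    (inj₁ eq)         → [m+d]%n≢m i z<s (lt (s≤s (s≤s z≤n))) (trans (sym s²) (sym eq))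
    (inj₂ (fwd , eq)) → [m+d]%n≢m i z<s (lt (s≤s z≤n)) (trans (sym s¹) (sym (sucMod-injective n eq)))
    (inj₂ (bwd , eq)) → [m+d]%n≢m i z<s (lt (s≤s (s≤s (s≤s z≤n)))) (trans (sym s³) eq)
  where
  lt : ∀ {d} → d ≤ 4 → d < n
  lt d≤4 = ≤-<-trans d≤4 4<n
  s¹ : sucMod n i ≡ (i + 1) % n
  s¹ = trans (cong (sucMod n) (sym ([m+0]%n≡m i<n))) (sucMod-+% n i 0)
  s² : sucMod n (sucMod n i) ≡ (i + 2) % n
  s² = trans (cong (sucMod n) s¹) (sucMod-+% n i 1)
  s³ : sucMod n (sucMod n (sucMod n i)) ≡ (i + 3) % n
  s³ = trans (cong (sucMod n) s²) (sucMod-+% n i 2)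

adj : ℕ → ℕ → ℕ → Bool
adj n i j = (i ≡ᵇ j) ∨ (sucMod n i ≡ᵇ j) ∨ (sucMod n j ≡ᵇ i)

adj⁺ : ∀ n i j → Adjacent n i j → T (adj n i j)
adj⁺ n i j (inj₁ eq)         = T-∨ˡ _ (≡⇒≡ᵇ i j eq)
adj⁺ n i j (inj₂ (fwd , eq)) = T-∨ʳ (i ≡ᵇ j) (T-∨ˡ _ (≡⇒≡ᵇ (sucMod n i) j eq))
adj⁺ n i j (inj₂ (bwd , eq)) = T-∨ʳ (i ≡ᵇ j) (T-∨ʳ (sucMod n i ≡ᵇ j) (≡⇒≡ᵇ (sucMod n j) i eq))

adj⁻ : ∀ n i j → T (adj n i j) → Adjacent n i j
adj⁻ n i j t with to T-∨ t
... | inj₁ eq = inj₁ (≡ᵇ⇒≡ i j eq)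
... | inj₂ t′ with to T-∨ t′
...   | inj₁ eq = inj₂ (fwd , ≡ᵇ⇒≡ (sucMod n i) j eq)
...   | inj₂ eq = inj₂ (bwd , ≡ᵇ⇒≡ (sucMod n j) i eq)

adjacent? : ∀ n i j → Dec (Adjacent n i j)
adjacent? n i j = map′ (adj⁻ n i j) (adj⁺ n i j) (T? (adj n i j))

Step-keeps-direction : ∀ {n u v w} δ δ′ → Step n δ u v → Step n δ′ v w → u ≢ w → Step n δ v w
Step-keeps-direction fwd fwd _  vw _  = vw
Step-keeps-direction bwd bwd _  vw _  = vw
Step-keeps-direction {n} fwd bwd uv vw u≢w = ⊥-elim (u≢w (sucMod-injective n (trans uv (sym vw))))
Step-keeps-direction bwd fwd uv vw u≢w = ⊥-elim (u≢w (trans (sym uv) vw))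

-- u lies k steps from r in direction δ, stated without subtraction.
Displacement : (m : ℕ) .{{_ : NonZero m}} → Dir → ℕ → ℕ → ℕ → Set
Displacement m fwd r k u = (r + k) % m ≡ u
Displacement m bwd r k u = (u + k) % m ≡ r

Displacement-zero : ∀ {m} .{{_ : NonZero m}} δ {r} → r < m → Displacement m δ r 0 r
Displacement-zero fwd r<m = [m+0]%n≡m r<m
Displacement-zero bwd r<m = [m+0]%n≡m r<m

Displacement-step : ∀ {m} .{{_ : NonZero m}} δ {r k u v} → v < m →
                    Displacement m δ r k u → Step m δ u v → Displacement m δ r (suc k) v
Displacement-step {m} fwd {r} {k} _ ru uv = trans (sym (sucMod-+% m r k)) (trans (cong (sucMod m) ru) uv)
Displacement-step {m} bwd {r} {k} {u} {v} v<m ur vu = begin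
  (v + suc k) % m       ≡⟨ cong (_% m) (+-suc v k) ⟩
  (suc v + k) % m       ≡⟨ sym ([m%d+n]%d≡[m+n]%d (suc v) k m) ⟩
  (suc v % m + k) % m   ≡⟨ cong (λ i → (i + k) % m) (trans (sym (sucMod-< v<m)) vu) ⟩
  (u + k) % m           ≡⟨ ur ⟩
  r                     ∎
  where open ≡-Reasoning

Displacement-period : ∀ {m} .{{_ : NonZero m}} δ {r u} → r < m → u < m → Displacement m δ r m u → u ≡ r
Displacement-period {m} fwd {r} r<m _ ru = trans (sym ru) (trans ([m+n]%n≡m%n r m) (m<n⇒m%n≡m r<m))
Displacement-period {m} bwd {r} {u} _ u<m ur = trans (sym (trans ([m+n]%n≡m%n u m) (m<n⇒m%n≡m u<m))) ur

Edge : (m : ℕ) → Fin (suc m) → Fin (suc m) → Set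
Edge m x y = T (R m x y)

hub : (m : ℕ) → Fin (suc m)
hub = fromℕ

Edge-hubˡ : ∀ m {x} y → toℕ x ≡ m → Edge m x y
Edge-hubˡ m {x} y eq = T-∨ˡ _ (≡⇒≡ᵇ (toℕ x) m eq)

Edge-hubʳ : ∀ m x {y} → toℕ y ≡ m → Edge m x y
Edge-hubʳ m x {y} eq = T-∨ʳ (toℕ x ≡ᵇ m) (T-∨ˡ _ (≡⇒≡ᵇ (toℕ y) m eq))

Edge-adjacent : ∀ m x y → Adjacent m (toℕ x) (toℕ y) → Edge m x y
Edge-adjacent m x y a = T-∨ʳ (toℕ x ≡ᵇ m) (T-∨ʳ (toℕ y ≡ᵇ m) (adj⁺ m (toℕ x) (toℕ y) a))

Edge-refl : ∀ m x → Edge m x x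
Edge-refl m x = Edge-adjacent m x x (inj₁ refl)

Edge⁻ : ∀ m x y → Edge m x y → toℕ x ≡ m ⊎ toℕ y ≡ m ⊎ Adjacent m (toℕ x) (toℕ y)
Edge⁻ m x y e with to T-∨ e
... | inj₁ eq = inj₁ (≡ᵇ⇒≡ (toℕ x) m eq)
... | inj₂ e′ with to T-∨ e′
...   | inj₁ eq = inj₂ (inj₁ (≡ᵇ⇒≡ (toℕ y) m eq))
...   | inj₂ a  = inj₂ (inj₂ (adj⁻ m (toℕ x) (toℕ y) a))

∈-fW⁺ : ∀ {m S x} y → y ∈ S → Edge m x y → x ∈ fW m S
∈-fW⁺ {m} {S} {x} y y∈S e = ∈-tabulate⁺ (anyFin (suc m) ∘ S∧R) (anyFin⁺ (suc m) (S∧R x) y S∧Rxy)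
  where
  S∧R = λ x z → lookup S z ∧ R m x z
  S∧Rxy = from (T-∧ {lookup S y}) (∈⇒T-lookup y∈S , e)

∈-fW⁻ : ∀ {m S x} → x ∈ fW m S → ∃[ y ] y ∈ S × Edge m x y
∈-fW⁻ {m} {S} {x} x∈ with anyFin⁻ (suc m) (S∧R x) (∈-tabulate⁻ (anyFin (suc m) ∘ S∧R) x∈)
  where S∧R = λ x z → lookup S z ∧ R m x z
... | y , t with to (T-∧ {lookup S y}) t
...   | y∈S , e = y , T-lookup⇒∈ y∈S , e

fW-⊥ : ∀ m → fW m ⊥ ≡ ⊥
fW-⊥ m = Empty-unique λ (_ , x∈) → ∉⊥ (proj₁ (proj₂ (∈-fW⁻ x∈)))

fW²-nonempty : ∀ {m S} y → y ∈ S → fW m (fW m S) ≡ ⊤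
fW²-nonempty {m} y y∈S = ⊆-antisym ⊆⊤ λ {x} _ →
  ∈-fW⁺ (hub m) (∈-fW⁺ y y∈S (Edge-hubˡ m y (toℕ-fromℕ m))) (Edge-hubʳ m x (toℕ-fromℕ m))

-- Covers of the wheel by the n-cycle

record IsCycleCover (m n : ℕ) (a : ℕ → Subset (suc m)) : Set where
  field
    separated : ∀ {i j x y} → i < n → j < n → ¬ Adjacent n i j → x ∈ a i → y ∈ a j → ¬ Edge m x y
    forward   : ∀ {i x} → i < n → x ∈ a i → ∃[ y ] y ∈ a (sucMod n i) × Edge m x y

module CycleCover {m n : ℕ} .{{_ : NonZero m}} .{{_ : NonZero n}} (4<n : 4 < n)
                  {a : ℕ → Subset (suc m)} (cover : IsCycleCover m n a) where
  open IsCycleCover cover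

  no-skip : ∀ {i x z} → i < n → x ∈ a i → z ∈ a (sucMod n (sucMod n i)) → ¬ Edge m x z
  no-skip i<n = separated i<n (sucMod<n (sucMod<n i<n)) (¬Adjacent-skip 4<n i<n)

  ∉-next : ∀ {i x} → i < n → x ∈ a i → x ∉ a (sucMod n i)
  ∉-next {x = x} i<n x∈ x∈′ = no-skip i<n x∈ (proj₁ (proj₂ z)) (proj₂ (proj₂ z))
    where z = forward (sucMod<n i<n) x∈′

  off-hub : ∀ {i x} → i < n → x ∈ a i → toℕ x ≢ m
  off-hub i<n x∈ x≡hub = no-skip i<n x∈ (proj₁ (proj₂ z)) (Edge-hubˡ m (proj₁ z) x≡hub)
    where z = forward (sucMod<n i<n) (proj₁ (proj₂ (forward i<n x∈)))

  on-rim : ∀ {i x} → i < n → x ∈ a i → toℕ x < m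
  on-rim {x = x} i<n x∈ = ≤∧≢⇒< (toℕ≤pred[n] x) (off-hub i<n x∈)

  disjoint : ∀ {i j x} → i < n → j < n → x ∈ a i → x ∈ a j → i ≡ j
  disjoint {i} {j} {x} i<n j<n x∈i x∈j with adjacent? n i j
  ... | no ¬adj                 = ⊥-elim (separated i<n j<n ¬adj x∈i x∈j (Edge-refl m x))
  ... | yes (inj₁ i≡j)          = i≡j
  ... | yes (inj₂ (fwd , si≡j)) = ⊥-elim (∉-next i<n x∈i (subst (λ k → x ∈ a k) (sym si≡j) x∈j))
  ... | yes (inj₂ (bwd , sj≡i)) = ⊥-elim (∉-next j<n x∈j (subst (λ k → x ∈ a k) (sym sj≡i) x∈i))

  module Walk {x₀} (x₀∈ : x₀ ∈ a 0) where

    next : ∀ k {x} → x ∈ a (k % n) → ∃[ y ] y ∈ a (suc k % n) × Edge m x y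
    next k x∈ with forward (m%n<n k n) x∈
    ... | y , y∈ , e = y , subst (λ i → y ∈ a i) (sucMod-% n k) y∈ , e

    walk : ∀ k → ∃[ x ] x ∈ a (k % n)
    walk zero    = x₀ , subst (λ i → x₀ ∈ a i) (sym (0%n≡0 n)) x₀∈
    walk (suc k) = proj₁ step , proj₁ (proj₂ step)
      where step = next k (proj₂ (walk k))

    pt : ℕ → Fin (suc m)
    pt k = proj₁ (walk k)

    pt∈ : ∀ k → pt k ∈ a (k % n)
    pt∈ k = proj₂ (walk k)

    pos : ℕ → ℕ
    pos k = toℕ (pt k)

    pos<m : ∀ k → pos k < m
    pos<m k = on-rim (m%n<n k n) (pt∈ k)

    walk-edge : ∀ k → Edge m (pt k) (pt (suc k))
    walk-edge k = proj₂ (proj₂ (next k (pt∈ k)))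

    walk-moves : ∀ k → pt k ≢ pt (suc k)
    walk-moves k eq =
      ∉-next (m%n<n k n) (pt∈ k) (subst₂ (λ x i → x ∈ a i) (sym eq) (sym (sucMod-% n k)) (pt∈ (suc k)))

    walk-no-return : ∀ k → pos k ≢ pos (suc (suc k))
    walk-no-return k eq =
      no-skip (m%n<n k n) (pt∈ k) pt₂∈ (subst (Edge m (pt k)) (toℕ-injective eq) (Edge-refl m (pt k)))
      where
      pt₂∈ : pt (suc (suc k)) ∈ a (sucMod n (sucMod n (k % n)))
      pt₂∈ = subst (λ i → pt (suc (suc k)) ∈ a i)
               (sym (trans (cong (sucMod n) (sucMod-% n k)) (sucMod-% n (suc k)))) (pt∈ (suc (suc k)))

    walk-step : ∀ k → ∃[ δ ] Step m δ (pos k) (pos (suc k))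
    walk-step k with Edge⁻ m (pt k) (pt (suc k)) (walk-edge k)
    ... | inj₁ hubˡ               = ⊥-elim (off-hub (m%n<n k n) (pt∈ k) hubˡ)
    ... | inj₂ (inj₁ hubʳ)        = ⊥-elim (off-hub (m%n<n (suc k) n) (pt∈ (suc k)) hubʳ)
    ... | inj₂ (inj₂ (inj₁ same)) = ⊥-elim (walk-moves k (toℕ-injective same))
    ... | inj₂ (inj₂ (inj₂ step)) = step

    walk-direction : ∀ {δ} → Step m δ (pos 0) (pos 1) → ∀ k → Step m δ (pos k) (pos (suc k))
    walk-direction st zero    = st
    walk-direction {δ} st (suc k) =
      Step-keeps-direction δ (proj₁ (walk-step (suc k))) (walk-direction st k) (proj₂ (walk-step (suc k)))
        (walk-no-return k)

    walk-displacement : ∀ {δ} → Step m δ (pos 0) (pos 1) → ∀ k → Displacement m δ (pos 0) k (pos k)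
    walk-displacement {δ} st zero    = Displacement-zero δ (pos<m 0)
    walk-displacement {δ} st (suc k) =
      Displacement-step δ (pos<m (suc k)) (walk-displacement st k) (walk-direction st k)

    walk-period : pt m ≡ pt 0
    walk-period with walk-step 0
    ... | δ , st = toℕ-injective (Displacement-period δ (pos<m 0) (pos<m m) (walk-displacement st m))

  nonempty⇒n∣m : Nonempty (a 0) → n ∣ m
  nonempty⇒n∣m (x₀ , x₀∈) = m%n≡0⇒n∣m m n (trans m%n≡0%n (0%n≡0 n))
    where
    open Walk x₀∈
    m%n≡0%n : m % n ≡ 0 % n
    m%n≡0%n =
      disjoint (m%n<n m n) (m%n<n 0 n) (pt∈ m) (subst (λ x → x ∈ a (0 % n)) (sym walk-period) (pt∈ 0))

-- Equations and their preservation under H, S and P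

infixr 7 _⊓ₜ_

data Term : Set where
  var  : ℕ → Term
  _⊓ₜ_ : Term → Term → Term
  -ₜ_  : Term → Term
  𝟘ₜ   : Term
  fₜ   : Term → Term

eval : (A : Alg) → (ℕ → Alg.Carrier A) → Term → Alg.Carrier A
eval A ρ (var i)  = ρ i
eval A ρ (s ⊓ₜ t) = Alg._⊓_ A (eval A ρ s) (eval A ρ t)
eval A ρ (-ₜ t)   = Alg.-_ A (eval A ρ t)
eval A ρ 𝟘ₜ       = Alg.𝟘 A
eval A ρ (fₜ t)   = Alg.f A (eval A ρ t)

infix 4 _⊨_≈_

_⊨_≈_ : Alg → Term → Term → Set
A ⊨ s ≈ t = ∀ ρ → Alg._≈_ A (eval A ρ s) (eval A ρ t)

setoid : Alg → Setoid 0ℓ 0ℓ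
setoid A = record { isEquivalence = Alg.isEquiv A }

eval-cong : ∀ A {ρ σ} → (∀ i → Alg._≈_ A (ρ i) (σ i)) → ∀ t → Alg._≈_ A (eval A ρ t) (eval A σ t)
eval-cong A ρ≈σ (var i)  = ρ≈σ i
eval-cong A ρ≈σ (s ⊓ₜ t) = Alg.⊓-cong A (eval-cong A ρ≈σ s) (eval-cong A ρ≈σ t)
eval-cong A ρ≈σ (-ₜ t)   = Alg.neg-cong A (eval-cong A ρ≈σ t)
eval-cong A ρ≈σ 𝟘ₜ       = IsEquivalence.refl (Alg.isEquiv A)
eval-cong A ρ≈σ (fₜ t)   = Alg.f-cong A (eval-cong A ρ≈σ t)

eval-hom : ∀ {A B h} → IsHom A B h → ∀ ρ t → Alg._≈_ B (h (eval A ρ t)) (eval B (h ∘ ρ) t)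
eval-hom {B = B} hom ρ (var i)  = IsEquivalence.refl (Alg.isEquiv B)
eval-hom {B = B} hom ρ (s ⊓ₜ t) =
  IsEquivalence.trans (Alg.isEquiv B) (IsHom.h-⊓ hom _ _)
    (Alg.⊓-cong B (eval-hom hom ρ s) (eval-hom hom ρ t))
eval-hom {B = B} hom ρ (-ₜ t)   =
  IsEquivalence.trans (Alg.isEquiv B) (IsHom.h-neg hom _) (Alg.neg-cong B (eval-hom hom ρ t))
eval-hom {B = B} hom ρ 𝟘ₜ       = IsHom.h-𝟘 hom
eval-hom {B = B} hom ρ (fₜ t)   =
  IsEquivalence.trans (Alg.isEquiv B) (IsHom.h-f hom _) (Alg.f-cong B (eval-hom hom ρ t))

eval-Π : ∀ I (A : I → Alg) ρ t i → eval (Π I A) ρ t i ≡ eval (A i) (λ v → ρ v i) t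
eval-Π I A ρ (var v)  i = refl
eval-Π I A ρ (s ⊓ₜ t) i = cong₂ (Alg._⊓_ (A i)) (eval-Π I A ρ s i) (eval-Π I A ρ t i)
eval-Π I A ρ (-ₜ t)   i = cong (Alg.-_ (A i)) (eval-Π I A ρ t i)
eval-Π I A ρ 𝟘ₜ       i = refl
eval-Π I A ρ (fₜ t)   i = cong (Alg.f (A i)) (eval-Π I A ρ t i)

eval-Sub : ∀ A P S ρ t → proj₁ (eval (Sub A P S) ρ t) ≡ eval A (proj₁ ∘ ρ) t
eval-Sub A P S ρ (var v)  = refl
eval-Sub A P S ρ (s ⊓ₜ t) = cong₂ (Alg._⊓_ A) (eval-Sub A P S ρ s) (eval-Sub A P S ρ t)
eval-Sub A P S ρ (-ₜ t)   = cong (Alg.-_ A) (eval-Sub A P S ρ t)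
eval-Sub A P S ρ 𝟘ₜ       = refl
eval-Sub A P S ρ (fₜ t)   = cong (Alg.f A) (eval-Sub A P S ρ t)

⊨-Π : ∀ I (A : I → Alg) {s t} → (∀ i → A i ⊨ s ≈ t) → Π I A ⊨ s ≈ t
⊨-Π I A {s} {t} hold ρ i = begin
  eval (Π I A) ρ s i  ≡⟨ eval-Π I A ρ s i ⟩
  eval (A i) ρᵢ s     ≈⟨ hold i ρᵢ ⟩
  eval (A i) ρᵢ t     ≡⟨ eval-Π I A ρ t i ⟨
  eval (Π I A) ρ t i  ∎
  where
  open SetoidReasoning (setoid (A i))
  ρᵢ = λ v → ρ v i

⊨-Sub : ∀ A P S {s t} → A ⊨ s ≈ t → Sub A P S ⊨ s ≈ t
⊨-Sub A P S {s} {t} hold ρ = begin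
  proj₁ (eval (Sub A P S) ρ s)  ≡⟨ eval-Sub A P S ρ s ⟩
  eval A (proj₁ ∘ ρ) s          ≈⟨ hold (proj₁ ∘ ρ) ⟩
  eval A (proj₁ ∘ ρ) t          ≡⟨ eval-Sub A P S ρ t ⟨
  proj₁ (eval (Sub A P S) ρ t)  ∎
  where open SetoidReasoning (setoid A)

⊨-image : ∀ A B {h s t} → IsHom A B h → Surjective A B h → A ⊨ s ≈ t → B ⊨ s ≈ t
⊨-image A B {h} {s} {t} hom surj hold ρ = begin
  eval B ρ s          ≈⟨ eval-cong B ρ≈hρ′ s ⟩
  eval B (h ∘ ρ′) s   ≈⟨ eval-hom hom ρ′ s ⟨
  h (eval A ρ′ s)     ≈⟨ IsHom.h-cong hom (hold ρ′) ⟩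
  h (eval A ρ′ t)     ≈⟨ eval-hom hom ρ′ t ⟩
  eval B (h ∘ ρ′) t   ≈⟨ eval-cong B ρ≈hρ′ t ⟨
  eval B ρ t          ∎
  where
  open SetoidReasoning (setoid B)
  ρ′ = λ i → proj₁ (surj (ρ i))
  ρ≈hρ′ = λ i → IsEquivalence.sym (Alg.isEquiv B) (proj₂ (surj (ρ i)))

⊨-HSP : ∀ {J K s t} → (∀ j → K j ⊨ s ≈ t) → ∀ A → HSP J K A → A ⊨ s ≈ t
⊨-HSP {K = K} {s} {t} hold A (I , ι , P , S , h , hom , surj) =
  ⊨-image _ A {s = s} {t} hom surj (⊨-Sub _ P S {s} {t} (⊨-Π I (K ∘ ι) {s} {t} (hold ∘ ι)))

generator∈HSP : ∀ J K j → HSP J K (K j)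
generator∈HSP J K j =
  Unit , (λ _ → j) , (λ _ → Unit) ,
  record { ⊓-closed = λ _ _ → tt ; neg-closed = λ _ → tt ; 𝟘-closed = tt ; f-closed = λ _ → tt } ,
  (λ x → proj₁ x tt) ,
  record { h-cong = λ eq → eq tt ; h-⊓ = λ _ _ → refl′ ; h-neg = λ _ → refl′ ; h-𝟘 = refl′
         ; h-f = λ _ → refl′ } ,
  (λ b → ((λ _ → b) , tt) , refl′)
  where refl′ = λ {x} → IsEquivalence.refl (Alg.isEquiv (K j)) {x}

-- The separating term

infixr 7 _∩ₑ_ _─ₑ_
infixr 6 _∪ₑ_

-- No absolute complement: these operations are preserved by both axis embeddings 𝔚ₘ → 𝔚♯ₘ.
data Expr : Set where
  varₑ           : ℕ → Expr
  ∅ₑ             : Expr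
  _∪ₑ_ _∩ₑ_ _─ₑ_ : Expr → Expr → Expr
  fₑ             : Expr → Expr

⟦_⟧ : ∀ {m} → Expr → (ℕ → Subset (suc m)) → Subset (suc m)
⟦ varₑ i ⟧  σ = σ i
⟦ ∅ₑ ⟧      σ = ⊥
⟦ d ∪ₑ e ⟧  σ = ⟦ d ⟧ σ ∪ ⟦ e ⟧ σ
⟦ d ∩ₑ e ⟧  σ = ⟦ d ⟧ σ ∩ ⟦ e ⟧ σ
⟦ d ─ₑ e ⟧  σ = ⟦ d ⟧ σ ∩ ∁ (⟦ e ⟧ σ)
⟦_⟧ {m} (fₑ e) σ = fW m (⟦ e ⟧ σ)

⟦⟧-cong : ∀ {m} {σ τ : ℕ → Subset (suc m)} → (∀ i → σ i ≡ τ i) → ∀ e → ⟦ e ⟧ σ ≡ ⟦ e ⟧ τ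
⟦⟧-cong σ≡τ (varₑ i) = σ≡τ i
⟦⟧-cong σ≡τ ∅ₑ       = refl
⟦⟧-cong σ≡τ (d ∪ₑ e) = cong₂ _∪_ (⟦⟧-cong σ≡τ d) (⟦⟧-cong σ≡τ e)
⟦⟧-cong σ≡τ (d ∩ₑ e) = cong₂ _∩_ (⟦⟧-cong σ≡τ d) (⟦⟧-cong σ≡τ e)
⟦⟧-cong σ≡τ (d ─ₑ e) = cong₂ (λ p q → p ∩ ∁ q) (⟦⟧-cong σ≡τ d) (⟦⟧-cong σ≡τ e)
⟦⟧-cong {m} σ≡τ (fₑ e) = cong (fW m) (⟦⟧-cong σ≡τ e)

-- Variable 0 is reserved for the argument of uₜ, hence the shift.
relativize : Term → Expr → Term
relativize u (varₑ i) = var (suc i) ⊓ₜ u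
relativize u ∅ₑ       = 𝟘ₜ
relativize u (d ∪ₑ e) = -ₜ (-ₜ relativize u d ⊓ₜ -ₜ relativize u e)
relativize u (d ∩ₑ e) = relativize u d ⊓ₜ relativize u e
relativize u (d ─ₑ e) = relativize u d ⊓ₜ -ₜ relativize u e
relativize u (fₑ e)   = fₜ (relativize u e)

⋃< : ℕ → (ℕ → Expr) → Expr
⋃< zero    F = ∅ₑ
⋃< (suc k) F = F k ∪ₑ ⋃< k F

module _ {m} {σ : ℕ → Subset (suc m)} {x : Fin (suc m)} where

  ∈-⋃<⁺ : ∀ {k i} (F : ℕ → Expr) → i < k → x ∈ ⟦ F i ⟧ σ → x ∈ ⟦ ⋃< k F ⟧ σ
  ∈-⋃<⁺ {suc k} F i<1+k x∈ with m<1+n⇒m<n∨m≡n i<1+k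
  ... | inj₁ i<k  = x∈p∪q⁺ (inj₂ (∈-⋃<⁺ F i<k x∈))
  ... | inj₂ refl = x∈p∪q⁺ (inj₁ x∈)

  ∈-⋃<⁻ : ∀ k (F : ℕ → Expr) → x ∈ ⟦ ⋃< k F ⟧ σ → ∃[ i ] i < k × x ∈ ⟦ F i ⟧ σ
  ∈-⋃<⁻ zero    F x∈ = ⊥-elim (∉⊥ x∈)
  ∈-⋃<⁻ (suc k) F x∈ with x∈p∪q⁻ (⟦ F k ⟧ σ) _ x∈
  ... | inj₁ x∈Fk = k , ≤-refl , x∈Fk
  ... | inj₂ x∈⋃  with ∈-⋃<⁻ k F x∈⋃
  ...   | i , i<k , x∈Fi = i , m<n⇒m<1+n i<k , x∈Fi

clash : ℕ → ℕ → ℕ → Expr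
clash n i j with adjacent? n i j
... | yes _ = ∅ₑ
... | no _  = varₑ i ∩ₑ fₑ (varₑ j)

gap : ℕ → ℕ → Expr
gap n i = varₑ i ─ₑ fₑ (varₑ (sucMod n i))

defects : ℕ → Expr
defects n = ⋃< n (λ i → ⋃< n (clash n i)) ∪ₑ ⋃< n (gap n)

separator : ℕ → Expr
separator n = varₑ 0 ─ₑ fₑ (fₑ (defects n))

defect-free⇒IsCycleCover : ∀ {m n} .{{_ : NonZero n}} {σ : ℕ → Subset (suc m)} →
                           Empty (⟦ defects n ⟧ σ) → IsCycleCover m n σ
defect-free⇒IsCycleCover {m} {n} {σ} no-defect = record { separated = separated ; forward = forward }
  where
  separated : ∀ {i j x y} → i < n → j < n → ¬ Adjacent n i j → x ∈ σ i → y ∈ σ j → ¬ Edge m x y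
  separated {i} {j} {x} {y} i<n j<n ¬adj x∈ y∈ e =
    no-defect (x , x∈p∪q⁺ (inj₁ (∈-⋃<⁺ _ i<n (∈-⋃<⁺ _ j<n x∈clash))))
    where
    x∈clash : x ∈ ⟦ clash n i j ⟧ σ
    x∈clash with adjacent? n i j
    ... | yes adj = ⊥-elim (¬adj adj)
    ... | no _    = x∈p∩q⁺ (x∈ , ∈-fW⁺ y y∈ e)
  forward : ∀ {i x} → i < n → x ∈ σ i → ∃[ y ] y ∈ σ (sucMod n i) × Edge m x y
  forward {i} {x} i<n x∈ with x ∈? fW m (σ (sucMod n i))
  ... | yes x∈f = ∈-fW⁻ x∈f
  ... | no  x∉f = ⊥-elim (no-defect (x , x∈p∪q⁺ (inj₂ (∈-⋃<⁺ (gap n) i<n (x∈p∩q⁺ (x∈ , x∉p⇒x∈∁p x∉f))))))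

separator-vanishes : ∀ {m n} .{{_ : NonZero m}} .{{_ : NonZero n}} → 4 < n → ¬ n ∣ m →
                     (σ : ℕ → Subset (suc m)) → ⟦ separator n ⟧ σ ≡ ⊥
separator-vanishes {m} {n} 4<n n∤m σ with nonempty? (⟦ defects n ⟧ σ)
... | yes (y , y∈D) = begin
  σ 0 ∩ ∁ (fW m (fW m (⟦ defects n ⟧ σ)))  ≡⟨ cong (λ p → σ 0 ∩ ∁ p) (fW²-nonempty y y∈D) ⟩
  σ 0 ∩ ∁ ⊤                                ≡⟨ cong (σ 0 ∩_) ∁⊤≡⊥ ⟩
  σ 0 ∩ ⊥                                  ≡⟨ ∩-zeroʳ (σ 0) ⟩
  ⊥                                        ∎
  where open ≡-Reasoning
... | no D-empty = Empty-unique λ (x , x∈) →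
  n∤m (CycleCover.nonempty⇒n∣m 4<n (defect-free⇒IsCycleCover D-empty) (x , proj₁ (x∈p∩q⁻ (σ 0) _ x∈)))

module _ {n : ℕ} .{{_ : NonZero n}} where

  points-clash-free : ∀ {i j x} → i < n → j < n → x ∉ ⟦ clash n i j ⟧ (point {suc n})
  points-clash-free {i} {j} {x} i<n j<n x∈ with adjacent? n i j
  ... | yes _   = ∉⊥ x∈
  ... | no ¬adj with x∈p∩q⁻ (point i) _ x∈
  ...   | x∈i , x∈fj with ∈-fW⁻ x∈fj
  ...     | y , y∈j , e with Edge⁻ n x y e
  ...       | inj₁ x≡n        = <-irrefl (trans (sym (∈-point⁻ x∈i)) x≡n) i<n
  ...       | inj₂ (inj₁ y≡n) = <-irrefl (trans (sym (∈-point⁻ y∈j)) y≡n) j<n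
  ...       | inj₂ (inj₂ adj) = ¬adj (subst₂ (Adjacent n) (∈-point⁻ x∈i) (∈-point⁻ y∈j) adj)

  points-gap-free : ∀ {i x} → i < n → x ∉ ⟦ gap n i ⟧ (point {suc n})
  points-gap-free {i} {x} i<n x∈ with x∈p∩q⁻ (point i) _ x∈
  ... | x∈i , x∉f =
    x∈∁p⇒x∉p x∉f (∈-fW⁺ y (∈-point⁺ (toℕ-fromℕ< si<1+n)) (Edge-adjacent n x y (inj₂ (fwd , x→y))))
    where
    si<1+n = m<n⇒m<1+n (sucMod<n i<n)
    y = fromℕ< si<1+n
    x→y : sucMod n (toℕ x) ≡ toℕ y
    x→y = trans (cong (sucMod n) (∈-point⁻ x∈i)) (sym (toℕ-fromℕ< si<1+n))

  points-defect-free : Empty (⟦ defects n ⟧ (point {suc n}))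
  points-defect-free (x , x∈) with x∈p∪q⁻ _ _ x∈
  ... | inj₁ x∈clashes with ∈-⋃<⁻ n _ x∈clashes
  ...   | i , i<n , x∈clashesᵢ with ∈-⋃<⁻ n _ x∈clashesᵢ
  ...     | j , j<n , x∈clash = points-clash-free i<n j<n x∈clash
  points-defect-free (x , x∈) | inj₂ x∈gaps with ∈-⋃<⁻ n (gap n) x∈gaps
  ...   | i , i<n , x∈gap = points-gap-free i<n x∈gap

  0∈separator-points : fzero ∈ ⟦ separator n ⟧ (point {suc n})
  0∈separator-points = x∈p∩q⁺ (∈-point⁺ refl , x∉p⇒x∈∁p 0∉ff)
    where
    0∉ff : fzero ∉ fW n (fW n (⟦ defects n ⟧ point))
    0∉ff = subst (fzero ∉_) (sym (trans (cong (fW n ∘ fW n) (Empty-unique points-defect-free))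
                                        (trans (cong (fW n) (fW-⊥ n)) (fW-⊥ n)))) ∉⊥

-- For n ≥ 5 the Boolean R n 2 0 computes to false, so the edge e below is absurd.
fW-point0-not-full : ∀ {n} → 4 < n → ∃[ z ] z ∉ fW n (point 0)
fW-point0-not-full {n} (s≤s (s≤s (s≤s (s≤s (s≤s _))))) = two , two∉
  where
  two : Fin (suc n)
  two = fsuc (fsuc fzero)
  two∉ : two ∉ fW n (point 0)
  two∉ two∈ with ∈-fW⁻ two∈
  ... | y , y∈0 , e with toℕ-injective {j = fzero} (∈-point⁻ y∈0)
  ...   | refl = e


π₀ₜ uₜ : Term
π₀ₜ = fₜ (fₜ (var 0)) ⊓ₜ -ₜ fₜ (var 0)
uₜ  = fₜ (fₜ π₀ₜ)

separatorₜ : ℕ → Term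
separatorₜ n = relativize uₜ (separator n)

-- The algebras 𝔚♯

infixr 7 _⊓²_

_⊓²_ : ∀ {m} → Pair m → Pair m → Pair m
x ⊓² y = proj₁ x ∩ proj₁ y , proj₂ x ∩ proj₂ y

module Sharp {m : ℕ} (G : SharpOp m) where
  open IsSharpOp (proj₂ G)
  open ≡-Reasoning

  W : Alg
  W = 𝔚♯ m G

  g : Pair m → Pair m
  g = proj₁ G

  g-𝟘 : g (⊥ , ⊥) ≡ (⊥ , ⊥)
  g-𝟘 = trans (on-a0 ⊥) (cong (_, ⊥) (fW-⊥ m))

  g-∁² : ∀ x → g (∁² x) ≡ ∁² (g x)
  g-∁² (a , b) with trivial-or-proper a | trivial-or-proper b
  ... | _ | inj₁ (inj₁ refl) = begin
    g (∁ a , ∁ ⊥)               ≡⟨ cong (λ c → g (∁ a , c)) ∁⊥≡⊤ ⟩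
    g (∁ a , ⊤)                 ≡⟨ on-a1 (∁ a) ⟩
    (∁ (fW m (∁ (∁ a))) , ⊤)    ≡⟨ cong₂ _,_ (cong (∁ ∘ fW m) (∁-involutive a)) (sym ∁⊥≡⊤) ⟩
    ∁² (fW m a , ⊥)             ≡⟨ cong ∁² (on-a0 a) ⟨
    ∁² (g (a , ⊥))              ∎
  ... | _ | inj₁ (inj₂ refl) = begin
    g (∁ a , ∁ ⊤)               ≡⟨ cong (λ c → g (∁ a , c)) ∁⊤≡⊥ ⟩
    g (∁ a , ⊥)                 ≡⟨ on-a0 (∁ a) ⟩
    (fW m (∁ a) , ⊥)            ≡⟨ cong₂ _,_ (∁-involutive _) ∁⊤≡⊥ ⟨
    ∁² (∁ (fW m (∁ a)) , ⊤)     ≡⟨ cong ∁² (on-a1 a) ⟨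
    ∁² (g (a , ⊤))              ∎
  ... | inj₁ (inj₁ refl) | _ = begin
    g (∁ ⊥ , ∁ b)               ≡⟨ cong (λ c → g (c , ∁ b)) ∁⊥≡⊤ ⟩
    g (⊤ , ∁ b)                 ≡⟨ on-1a (∁ b) ⟩
    (⊤ , ∁ (fW m (∁ (∁ b))))    ≡⟨ cong₂ _,_ (sym ∁⊥≡⊤) (cong (∁ ∘ fW m) (∁-involutive b)) ⟩
    ∁² (⊥ , fW m b)             ≡⟨ cong ∁² (on-0a b) ⟨
    ∁² (g (⊥ , b))              ∎
  ... | inj₁ (inj₂ refl) | _ = begin
    g (∁ ⊤ , ∁ b)               ≡⟨ cong (λ c → g (c , ∁ b)) ∁⊤≡⊥ ⟩
    g (⊥ , ∁ b)                 ≡⟨ on-0a (∁ b) ⟩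
    (⊥ , fW m (∁ b))            ≡⟨ cong₂ _,_ ∁⊤≡⊥ (∁-involutive _) ⟨
    ∁² (⊤ , ∁ (fW m (∁ b)))     ≡⟨ cong ∁² (on-1a b) ⟨
    ∁² (g (⊤ , b))              ∎
  ... | inj₂ a-proper | inj₂ b-proper = cond-i a b a-proper b-proper

  normal : W ⊨ fₜ 𝟘ₜ ≈ 𝟘ₜ
  normal _ = g-𝟘

  unit-preserving : W ⊨ fₜ (-ₜ 𝟘ₜ) ≈ -ₜ 𝟘ₜ
  unit-preserving _ = trans (g-∁² (⊥ , ⊥)) (cong ∁² g-𝟘)

  semi-complemented : W ⊨ fₜ (-ₜ var 0) ≈ -ₜ fₜ (var 0)
  semi-complemented ρ = g-∁² (ρ 0)

  g-fixes-trivial₁ : ∀ {x} → Trivial (proj₁ x) → proj₁ (g x) ≡ proj₁ x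
  g-fixes-trivial₁ {_ , b} (inj₁ refl) = cong proj₁ (on-0a b)
  g-fixes-trivial₁ {_ , b} (inj₂ refl) = cong proj₁ (on-1a b)

  g-fixes-trivial₂ : ∀ {x} → Trivial (proj₂ x) → proj₂ (g x) ≡ proj₂ x
  g-fixes-trivial₂ {a , _} (inj₁ refl) = cong proj₂ (on-a0 a)
  g-fixes-trivial₂ {a , _} (inj₂ refl) = cong proj₂ (on-a1 a)

  g-preserves-trivial₁ : ∀ {x} → Trivial (proj₁ x) → Trivial (proj₁ (g x))
  g-preserves-trivial₁ t = subst Trivial (sym (g-fixes-trivial₁ t)) t

  g-preserves-trivial₂ : ∀ {x} → Trivial (proj₂ x) → Trivial (proj₂ (g x))
  g-preserves-trivial₂ t = subst Trivial (sym (g-fixes-trivial₂ t)) t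

  π₀ : Pair m → Pair m
  π₀ x = g (g x) ⊓² ∁² (g x)

  π₀-vanishes₁ : ∀ x → Trivial (proj₁ (g x)) → proj₁ (π₀ x) ≡ ⊥
  π₀-vanishes₁ x t = trans (cong (_∩ ∁ (proj₁ (g x))) (g-fixes-trivial₁ t)) (∩-inverseʳ _)

  π₀-vanishes₂ : ∀ x → Trivial (proj₂ (g x)) → proj₂ (π₀ x) ≡ ⊥
  π₀-vanishes₂ x t = trans (cong (_∩ ∁ (proj₂ (g x))) (g-fixes-trivial₂ t)) (∩-inverseʳ _)

  π₀-degenerate : ∀ x → proj₁ (π₀ x) ≡ ⊥ ⊎ proj₂ (π₀ x) ≡ ⊥
  π₀-degenerate (a , b) with trivial-or-proper a | trivial-or-proper b
  ... | inj₁ a-trivial  | _              = inj₁ (π₀-vanishes₁ _ (g-preserves-trivial₁ a-trivial))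
  ... | inj₂ _          | inj₁ b-trivial = inj₂ (π₀-vanishes₂ _ (g-preserves-trivial₂ b-trivial))
  ... | inj₂ a-proper   | inj₂ b-proper  =
    inj₂ (π₀-vanishes₂ _ (Sum.map (cong proj₂) (cong proj₂) (proper-values a b a-proper b-proper)))

  record Axis : Set where
    field
      ι          : Subset (suc m) → Pair m
      π          : Pair m → Subset (suc m)
      ι-⊥        : ι ⊥ ≡ (⊥ , ⊥)
      ι-∪        : ∀ a b → ∁² (∁² (ι a) ⊓² ∁² (ι b)) ≡ ι (a ∪ b)
      ι-∩        : ∀ a b → ι a ⊓² ι b ≡ ι (a ∩ b)
      ι-─        : ∀ a b → ι a ⊓² ∁² (ι b) ≡ ι (a ∩ ∁ b)
      ι-g        : ∀ a → g (ι a) ≡ ι (fW m a)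
      ι-restrict : ∀ x t → x ⊓² ι t ≡ ι (π x ∩ t)

  axis₁ : Axis
  axis₁ = record
    { ι          = _, ⊥
    ; π          = proj₁
    ; ι-⊥        = refl
    ; ι-∪        = λ a b → cong₂ _,_ (∁-∩-∁ a b) ∁[∁⊥∩∁⊥]≡⊥
    ; ι-∩        = λ a b → cong (a ∩ b ,_) (∩-zeroˡ ⊥)
    ; ι-─        = λ a b → cong (a ∩ ∁ b ,_) (∩-zeroˡ (∁ ⊥))
    ; ι-g        = on-a0
    ; ι-restrict = λ x t → cong (proj₁ x ∩ t ,_) (∩-zeroʳ (proj₂ x))
    }

  axis₂ : Axis
  axis₂ = record
    { ι          = ⊥ ,_
    ; π          = proj₂
    ; ι-⊥        = refl
    ; ι-∪        = λ a b → cong₂ _,_ ∁[∁⊥∩∁⊥]≡⊥ (∁-∩-∁ a b)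
    ; ι-∩        = λ a b → cong (_, a ∩ b) (∩-zeroˡ ⊥)
    ; ι-─        = λ a b → cong (_, a ∩ ∁ b) (∩-zeroˡ (∁ ⊥))
    ; ι-g        = on-0a
    ; ι-restrict = λ x t → cong (_, proj₂ x ∩ t) (∩-zeroʳ (proj₁ x))
    }

  OnAxis : Pair m → Set
  OnAxis x = Σ Axis λ A → ∃[ t ] x ≡ Axis.ι A t

  π₀-OnAxis : ∀ x → OnAxis (π₀ x)
  π₀-OnAxis x with π₀-degenerate x
  ... | inj₁ eq = axis₂ , proj₂ (π₀ x) , cong (_, proj₂ (π₀ x)) eq
  ... | inj₂ eq = axis₁ , proj₁ (π₀ x) , cong (proj₁ (π₀ x) ,_) eq

  π₀-ι : (A : Axis) → ∀ a → π₀ (Axis.ι A a) ≡ Axis.ι A (fW m (fW m a) ∩ ∁ (fW m a))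
  π₀-ι A a = trans (cong₂ (λ p q → p ⊓² ∁² q) (trans (cong g (ι-g a)) (ι-g (fW m a))) (ι-g a)) (ι-─ _ _)
    where open Axis A

  uₜ-OnAxis : ∀ ρ → OnAxis (eval W ρ uₜ)
  uₜ-OnAxis ρ with π₀-OnAxis (ρ 0)
  ... | A , t , eq = A , fW m (fW m t) , trans (cong (g ∘ g) eq) (trans (cong g (ι-g t)) (ι-g (fW m t)))
    where open Axis A

  module _ (A : Axis) where
    open Axis A

    eval-relativize : ∀ {u t ρ} → eval W ρ u ≡ ι t →
                      ∀ e → eval W ρ (relativize u e) ≡ ι (⟦ e ⟧ (λ i → π (ρ (suc i)) ∩ t))
    eval-relativize {ρ = ρ} u≡ιt (varₑ i) = trans (cong (ρ (suc i) ⊓²_) u≡ιt) (ι-restrict (ρ (suc i)) _)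
    eval-relativize u≡ιt ∅ₑ       = sym ι-⊥
    eval-relativize u≡ιt (d ∪ₑ e) =
      trans (cong₂ (λ p q → ∁² (∁² p ⊓² ∁² q)) (eval-relativize u≡ιt d) (eval-relativize u≡ιt e)) (ι-∪ _ _)
    eval-relativize u≡ιt (d ∩ₑ e) =
      trans (cong₂ _⊓²_ (eval-relativize u≡ιt d) (eval-relativize u≡ιt e)) (ι-∩ _ _)
    eval-relativize u≡ιt (d ─ₑ e) =
      trans (cong₂ (λ p q → p ⊓² ∁² q) (eval-relativize u≡ιt d) (eval-relativize u≡ιt e)) (ι-─ _ _)
    eval-relativize u≡ιt (fₑ e)   = trans (cong g (eval-relativize u≡ιt e)) (ι-g _)

  separatorₜ-holds : ∀ {n} .{{_ : NonZero m}} .{{_ : NonZero n}} → 4 < n → ¬ n ∣ m →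
                     W ⊨ separatorₜ n ≈ 𝟘ₜ
  separatorₜ-holds {n} 4<n n∤m ρ with uₜ-OnAxis ρ
  ... | A , t , u≡ιt = begin
    eval W ρ (separatorₜ n)   ≡⟨ eval-relativize A u≡ιt (separator n) ⟩
    ι (⟦ separator n ⟧ _)     ≡⟨ cong ι (separator-vanishes 4<n n∤m _) ⟩
    ι ⊥                       ≡⟨ ι-⊥ ⟩
    (⊥ , ⊥)                   ∎
    where open Axis A

  Trivial₂ : Pred (Pair m) 0ℓ
  Trivial₂ x = Trivial (proj₂ x)

  Trivial₂-isSubuniverse : IsSubuniverse W Trivial₂
  Trivial₂-isSubuniverse = record
    { ⊓-closed   = ∩-closed
    ; neg-closed = λ where
        (inj₁ eq) → inj₂ (trans (cong ∁ eq) ∁⊥≡⊤)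
        (inj₂ eq) → inj₁ (trans (cong ∁ eq) ∁⊤≡⊥)
    ; 𝟘-closed   = inj₁ refl
    ; f-closed   = g-preserves-trivial₂
    }
    where
    ∩-closed : ∀ {a b : Subset (suc m)} → Trivial a → Trivial b → Trivial (a ∩ b)
    ∩-closed (inj₁ refl) _ = inj₁ (∩-zeroˡ _)
    ∩-closed (inj₂ refl) t = subst Trivial (sym (∩-identityˡ _)) t

  Sub₂ : Alg
  Sub₂ = Sub W Trivial₂ Trivial₂-isSubuniverse

  SameSecond : Rel (Alg.Carrier Sub₂) 0ℓ
  SameSecond x y = proj₂ (proj₁ x) ≡ proj₂ (proj₁ y)

  SameSecond-isCongruence : IsCongruence Sub₂ SameSecond
  SameSecond-isCongruence = record
    { equiv    = record { refl = refl ; sym = sym ; trans = trans }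
    ; ≈⊆Θ      = cong proj₂
    ; ⊓-comp   = cong₂ _∩_
    ; neg-comp = cong ∁
    ; f-comp   = λ {x} {x′} eq →
        trans (g-fixes-trivial₂ (proj₂ x)) (trans eq (sym (g-fixes-trivial₂ (proj₂ x′))))
    }

  ¬CEP : ∀ {b} → Proper b → ¬ CEP W
  ¬CEP {b} b-proper cep with cep Trivial₂ Trivial₂-isSubuniverse SameSecond SameSecond-isCongruence
                           | cond-ii-right b b-proper
  ... | Ψ , Ψ-isCongruence , restricts | (a₀ , _ , ga₀b≡𝟘) , (a₁ , _ , ga₁b≡𝟙) =
    ⊥≢⊤ (proj₁ (restricts 𝟘ᴮ 𝟙ᴮ) Ψ𝟘𝟙)
    where
    open IsCongruence Ψ-isCongruence
    module Ψ = IsEquivalence equiv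
    𝟘ᴮ 𝟙ᴮ : Alg.Carrier Sub₂
    𝟘ᴮ = (⊥ , ⊥) , inj₁ refl
    𝟙ᴮ = (⊤ , ⊤) , inj₂ refl
    Ψ𝟙⊥⊤ : Ψ (⊤ , ⊤) (⊥ , ⊤)
    Ψ𝟙⊥⊤ = proj₂ (restricts 𝟙ᴮ ((⊥ , ⊤) , inj₂ refl)) refl
    erase : ∀ a → Ψ (a , b) (⊥ , b)
    erase a = subst₂ Ψ (cong₂ _,_ (∩-identityˡ a) (∩-identityˡ b)) (cong₂ _,_ (∩-zeroˡ a) (∩-identityˡ b))
                (⊓-comp Ψ𝟙⊥⊤ (Ψ.refl {a , b}))
    Ψ𝟘𝟙 : Ψ (⊥ , ⊥) (⊤ , ⊤)
    Ψ𝟘𝟙 = Ψ.trans (subst₂ Ψ ga₀b≡𝟘 (on-0a b) (f-comp (erase a₀)))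
                  (Ψ.sym (subst₂ Ψ ga₁b≡𝟙 (on-0a b) (f-comp (erase a₁))))
    ⊥≢⊤ : ⊥ {suc m} ≢ ⊤
    ⊥≢⊤ ()

  separatorₜ-fails : 4 < m → ¬ (W ⊨ separatorₜ m ≈ 𝟘ₜ)
  separatorₜ-fails 4<m holds = ∉⊥ (subst (fzero ∈_) (cong proj₁ (holds ρ₀)) 0∈separatorₜ)
    where
    open Axis axis₁
    instance
      m≢0 : NonZero m
      m≢0 = >4⇒NonZero 4<m
    z = proj₁ (fW-point0-not-full 4<m)
    z∉f0 = proj₂ (fW-point0-not-full 4<m)
    ρ₀ : ℕ → Pair m
    ρ₀ zero    = point 0 , ⊥
    ρ₀ (suc i) = point i , ⊥
    u≡ι⊤ : eval W ρ₀ uₜ ≡ ι ⊤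
    u≡ι⊤ = begin
      g (g (π₀ (ι (point 0))))   ≡⟨ cong (g ∘ g) (π₀-ι axis₁ (point 0)) ⟩
      g (g (ι q))                ≡⟨ trans (cong g (ι-g q)) (ι-g (fW m q)) ⟩
      ι (fW m (fW m q))          ≡⟨ cong ι (fW²-nonempty z (x∈p∩q⁺ (z∈ff0 , x∉p⇒x∈∁p z∉f0))) ⟩
      ι ⊤                        ∎
      where
      q = fW m (fW m (point 0)) ∩ ∁ (fW m (point 0))
      z∈ff0 = subst (z ∈_) (sym (fW²-nonempty fzero (∈-point⁺ refl))) ∈⊤
    0∈separatorₜ : fzero ∈ proj₁ (eval W ρ₀ (separatorₜ m))
    0∈separatorₜ =
      subst (fzero ∈_) (sym (cong proj₁ evalₜ≡ι)) (subst (fzero ∈_) points≡σ 0∈separator-points)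
      where
      points≡σ : ⟦ separator m ⟧ point ≡ ⟦ separator m ⟧ (λ i → π (ρ₀ (suc i)) ∩ ⊤)
      points≡σ = ⟦⟧-cong (λ i → sym (∩-identityʳ (point i))) (separator m)
      evalₜ≡ι : eval W ρ₀ (separatorₜ m) ≡ ι (⟦ separator m ⟧ (λ i → π (ρ₀ (suc i)) ∩ ⊤))
      evalₜ≡ι = eval-relativize axis₁ u≡ι⊤ (separator m)

𝔚♯-family : SharpChoice → (X : Pred ℕ 0ℓ) → X ⊆ Prim → Σ ℕ X → Alg
𝔚♯-family F X X⊆Prim (n , Xn) = 𝔚♯ n (F n (X⊆Prim Xn))

module _ (F : SharpChoice) (X : Pred ℕ 0ℓ) (X⊆Prim : X ⊆ Prim) where

  𝔚♯∈V♯ : ∀ {n} (Xn : X n) → V♯ F X X⊆Prim (𝔚♯ n (F n (X⊆Prim Xn)))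
  𝔚♯∈V♯ {n} Xn = generator∈HSP (Σ ℕ X) (𝔚♯-family F X X⊆Prim) (n , Xn)

  V♯-⊨ : ∀ s t → (∀ n (Xn : X n) → 𝔚♯ n (F n (X⊆Prim Xn)) ⊨ s ≈ t) →
         ∀ A → V♯ F X X⊆Prim A → A ⊨ s ≈ t
  V♯-⊨ s t holds = ⊨-HSP {K = 𝔚♯-family F X X⊆Prim} {s = s} {t = t} λ (n , Xn) → holds n Xn

  V♯-normal : NormalClass (V♯ F X X⊆Prim)
  V♯-normal A A∈V =
    V♯-⊨ (fₜ 𝟘ₜ) 𝟘ₜ (λ n Xn → Sharp.normal (F n (X⊆Prim Xn))) A A∈V λ _ → Alg.𝟘 A

  V♯-unit-preserving : UnitPreservingClass (V♯ F X X⊆Prim)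
  V♯-unit-preserving A A∈V =
    V♯-⊨ (fₜ (-ₜ 𝟘ₜ)) (-ₜ 𝟘ₜ) (λ n Xn → Sharp.unit-preserving (F n (X⊆Prim Xn))) A A∈V λ _ → Alg.𝟘 A

  V♯-semi-complemented : SemiComplementedClass (V♯ F X X⊆Prim)
  V♯-semi-complemented A A∈V x =
    V♯-⊨ (fₜ (-ₜ var 0)) (-ₜ fₜ (var 0)) (λ n Xn → Sharp.semi-complemented (F n (X⊆Prim Xn))) A A∈V λ _ → x

  V♯-lacks-CEP : Σ ℕ X → LacksCEP (V♯ F X X⊆Prim)
  V♯-lacks-CEP (n , Xn) =
    _ , 𝔚♯∈V♯ Xn , Sharp.¬CEP (F n (X⊆Prim Xn)) (point0-proper (≤-<-trans z≤n (proj₂ (X⊆Prim Xn))))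

  V♯-⊨-separatorₜ : ∀ {n} → 4 < n → ¬ X n → ∀ A → V♯ F X X⊆Prim A → A ⊨ separatorₜ n ≈ 𝟘ₜ
  V♯-⊨-separatorₜ {n} 4<n ¬Xn = V♯-⊨ (separatorₜ n) 𝟘ₜ λ m Xm →
    Sharp.separatorₜ-holds (F m (X⊆Prim Xm)) {{>4⇒NonZero (proj₂ (X⊆Prim Xm))}} {{>4⇒NonZero 4<n}} 4<n
      (prime-∤ (proj₁ (X⊆Prim Xm)) (≤-<-trans (s≤s z≤n) 4<n) λ n≡m → ¬Xn (subst X (sym n≡m) Xm))

V♯-distinct : (F : SharpChoice) (X Y : Pred ℕ 0ℓ) (X⊆Prim : X ⊆ Prim) (Y⊆Prim : Y ⊆ Prim) →
              ∀ n → X n → ¬ Y n → ¬ SameClass (V♯ F X X⊆Prim) (V♯ F Y Y⊆Prim)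
V♯-distinct F X Y X⊆Prim Y⊆Prim n Xn ¬Yn X≡Y = Sharp.separatorₜ-fails (F n (X⊆Prim Xn)) 4<n
  (V♯-⊨-separatorₜ F Y Y⊆Prim 4<n ¬Yn _ (proj₁ (X≡Y _) (𝔚♯∈V♯ F X X⊆Prim Xn)))
  where 4<n = proj₂ (X⊆Prim Xn)

theorem2p19 : (F : SharpChoice) →
    ((X Y : Pred ℕ 0ℓ) (X⊆Prim : X ⊆ Prim) (Y⊆Prim : Y ⊆ Prim) →
      (n : ℕ) → X n → ¬ Y n →
      ¬ SameClass (V♯ F X X⊆Prim) (V♯ F Y Y⊆Prim))
    ×
    ((X : Pred ℕ 0ℓ) (X⊆Prim : X ⊆ Prim) → Σ ℕ X →
      NormalClass (V♯ F X X⊆Prim) × UnitPreservingClass (V♯ F X X⊆Prim) ×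
      SemiComplementedClass (V♯ F X X⊆Prim) × LacksCEP (V♯ F X X⊆Prim))
theorem2p19 F =
  V♯-distinct F ,
  λ X X⊆Prim X≢∅ → V♯-normal F X X⊆Prim , V♯-unit-preserving F X X⊆Prim ,
                   V♯-semi-complemented F X X⊆Prim , V♯-lacks-CEP F X X⊆Prim X≢∅
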